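{- Let $r \geqslant 0$, $t \geqslant 2$, $n \geqslant 1$ and $k \geqslant t$ be integers. Then $K_{t(n)}$ has an $r$-equitable $k$-coloring if and only if $\lceil n/\lfloor k/t \rfloor \rceil - \lfloor n/\lceil k/t \rceil \rfloor \leqslant r$.
   Context: All graphs are finite, simple and undirected. $K_{t(n)}$ denotes the complete $t$-partite graph with all $t$ partite sets of size $n$: the vertex set is partitioned into independent sets $V_1,\ldots,V_t$ with $|V_i|=n$, every vertex of $V_i$ adjacent to every vertex of $V_j$ for $i \neq j$. For a positive integer $k$, a (proper) $k$-coloring of a graph $G=(V,E)$ is a map $f: V \to \{1,\ldots,k\}$ with $f(u)\neq f(v)$ whenever $uv \in E$; the color classes are the sets $\{u \in V : f(u)=c\}$ for $c=1,\ldots,k$, and these may be empty. For an integer $r \geqslant 0$, a $k$-coloring is $r$-equitable if the sizes of any two of its $k$ color classes (including empty ones) differ by at most $r$. -}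

module Defs where

open import Data.Nat using (ℕ; zero; suc; _+_; _∸_; _≤_)
open import Data.Nat.DivMod using (_/_)
open import Data.Fin using (Fin)
open import Data.Fin.Properties using (_≟_)
open import Data.Product using (Σ; _×_; _,_; proj₁)
open import Data.List using (List; length; filter; cartesianProduct; allFin)
open import Relation.Nullary using (¬_)
open import Relation.Binary.PropositionalEquality using (_≡_)


-- Complete t-partite graph K_{t(n)} with vertex type Fin t × Fin n:
-- vertex (i , j) lies in part V_i; adjacency iff different parts.
vertices : (t n : ℕ) → List (Fin t × Fin n)
vertices t n = cartesianProduct (allFin t) (allFin n)

KAdj : {t n : ℕ} → Fin t × Fin n → Fin t × Fin n → Set
KAdj u v = ¬ (proj₁ u ≡ proj₁ v)

IsProperColoring : (t n k : ℕ) → (Fin t × Fin n → Fin k) → Set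
IsProperColoring t n k f = ∀ u v → KAdj u v → ¬ (f u ≡ f v)

classSize : (t n k : ℕ) → (Fin t × Fin n → Fin k) → Fin k → ℕ
classSize t n k f c = length (filter (λ v → f v ≟ c) (vertices t n))

-- r-equitable: any two classes (including empty ones) differ by at most r
IsREquitable : (r t n k : ℕ) → (Fin t × Fin n → Fin k) → Set
IsREquitable r t n k f = ∀ c c' → classSize t n k f c ≤ classSize t n k f c' + r

HasREquitableColoring : (r t n k : ℕ) → Set
HasREquitableColoring r t n k =
  Σ (Fin t × Fin n → Fin k) (λ f → IsProperColoring t n k f × IsREquitable r t n k f)

-- floor and ceiling division (divisor 0 gives 0; never used with divisor 0)
⌊_/_⌋ : ℕ → ℕ → ℕ
⌊ a / zero ⌋ = 0
⌊ a / suc d ⌋ = a / suc d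

⌈_/_⌉ : ℕ → ℕ → ℕ
⌈ a / zero ⌉ = 0
⌈ a / suc d ⌉ = (a + d) / suc d

-- In a proper colouring of K_{t(n)} every colour class lies inside one part, so the parts
-- share the k colours out disjointly. Some part then receives at most ⌊k/t⌋ colours and
-- its n vertices force a class of size at least ⌈n/⌊k/t⌋⌉; if no class is empty, some part
-- receives at least ⌈k/t⌉ colours and so has a class of size at most ⌊n/⌈k/t⌉⌋.
-- Conversely, give part i the colours c ≡ i (mod t), of which there are w_i ∈ [⌊k/t⌋, ⌈k/t⌉],
-- and colour its j-th vertex by residue j mod w_i: each class of part i then has size
-- ⌊n/w_i⌋ or ⌈n/w_i⌉, which lies between the two bounds above.
module Submission where

open import Defs
open import Level using (Level)
open import Data.Nat.Base using (ℕ; zero; suc; _+_; _*_; _∸_; _≤_; _<_; z≤n; s≤s; s≤s⁻¹; z<s; NonZero; >-nonZero)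
open import Data.Nat.Properties renaming (_≟_ to _≟ℕ_)
open import Data.Nat.DivMod
  using (_/_; _%_; m≡m%n+[m/n]*n; m%n<n; m<n⇒m%n≡m; [m+n]%n≡m%n; [m+kn]%n≡m%n; m/n*n≤m; m*n/n≡m;
         /-monoˡ-≤; m<n*o⇒m/o<n)
open import Data.Fin.Base using (Fin; zero; suc; toℕ; fromℕ<; punchIn)
open import Data.Fin.Properties using (_≟_; any?; toℕ-injective; toℕ-fromℕ<; toℕ<n; punchInᵢ≢i)
open import Data.Vec.Functional using (Vector)
open import Data.List.Base using (List; length; _++_; filter; cartesianProduct; tabulate; map)
open import Data.List.Properties using (length-++; filter-++; map-tabulate)
open import Data.Product using (∃; _×_; _,_; proj₁; proj₂)
open import Relation.Nullary using (¬_; Dec; yes; no; contradiction)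
open import Relation.Unary using (Pred; Decidable)
open import Relation.Binary.PropositionalEquality
open import Function.Base using (_∘_)
open import Function.Bundles using (_⇔_; mk⇔; Equivalence)
open import Algebra.Properties.Semiring.Sum +-*-semiring
  using (sum; sum-syntax; sum-cong-≗; sum-replicate-zero; sum-remove; ∑-comm; *-distribʳ-sum)

open Equivalence using (to; from)

private
  variable
    a b p : Level
    A : Set a
    B : Set b

𝟙 : Dec A → ℕ
𝟙 (yes _) = 1
𝟙 (no _)  = 0

𝟙-yes : (d : Dec A) → A → 𝟙 d ≡ 1
𝟙-yes (yes _) _ = refl
𝟙-yes (no ¬x) x = contradiction x ¬x

𝟙-no : (d : Dec A) → ¬ A → 𝟙 d ≡ 0
𝟙-no (yes x) ¬x = contradiction x ¬x
𝟙-no (no _)  _  = refl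

𝟙-cong : (d : Dec A) (e : Dec B) → A ⇔ B → 𝟙 d ≡ 𝟙 e
𝟙-cong (yes x) e A⇔B = sym (𝟙-yes e (to A⇔B x))
𝟙-cong (no ¬x) e A⇔B = sym (𝟙-no e (¬x ∘ from A⇔B))

∑-const : ∀ m c → ∑[ i < m ] c ≡ m * c
∑-const zero    c = refl
∑-const (suc m) c = cong (c +_) (∑-const m c)

∑-mono-≤ : ∀ {m} {g h : Vector ℕ m} → (∀ i → g i ≤ h i) → sum g ≤ sum h
∑-mono-≤ {zero}  _   = z≤n
∑-mono-≤ {suc m} g≤h = +-mono-≤ (g≤h zero) (∑-mono-≤ (g≤h ∘ suc))

∑-zero : ∀ {m} {g : Vector ℕ m} → (∀ i → g i ≡ 0) → sum g ≡ 0
∑-zero {m} g≡0 = trans (sum-cong-≗ g≡0) (sum-replicate-zero m)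

∑-single : ∀ {m} (g : Vector ℕ m) i → (∀ j → j ≢ i → g j ≡ 0) → sum g ≡ g i
∑-single {suc m} g i others≡0 = begin
  sum g                     ≡⟨ sum-remove {i = i} g ⟩
  g i + sum (g ∘ punchIn i) ≡⟨ cong (g i +_) (∑-zero (λ j → others≡0 (punchIn i j) (punchInᵢ≢i i j))) ⟩
  g i + 0                   ≡⟨ +-identityʳ (g i) ⟩
  g i                       ∎
  where open ≡-Reasoning

∑-𝟙-zero : ∀ {m} {P : Pred (Fin m) p} (P? : Decidable P) → (∀ i → ¬ P i) → ∑[ i < m ] 𝟙 (P? i) ≡ 0
∑-𝟙-zero P? ¬P = ∑-zero (λ i → 𝟙-no (P? i) (¬P i))

∑-𝟙-one : ∀ {m} {P : Pred (Fin m) p} (P? : Decidable P) {i} → P i → (∀ {j} → P j → j ≡ i) →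
          ∑[ j < m ] 𝟙 (P? j) ≡ 1
∑-𝟙-one P? {i} Pi unique =
  trans (∑-single _ i (λ j j≢i → 𝟙-no (P? j) (j≢i ∘ unique))) (𝟙-yes (P? i) Pi)

∑-𝟙-≤1 : ∀ {m} {P : Pred (Fin m) p} (P? : Decidable P) → (∀ {i j} → P i → P j → i ≡ j) →
         ∑[ i < m ] 𝟙 (P? i) ≤ 1
∑-𝟙-≤1 P? unique with any? P?
... | yes (i , Pi) = ≤-reflexive (∑-𝟙-one P? Pi (λ Pj → unique Pj Pi))
... | no ¬∃P       = ≤-trans (≤-reflexive (∑-𝟙-zero P? (λ i Pi → ¬∃P (i , Pi)))) z≤n

argmin : ∀ {m} → 0 < m → (g : Vector ℕ m) → ∃ λ i → ∀ j → g i ≤ g j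
argmin {suc zero}    _ g = zero , λ { zero → ≤-refl }
argmin {suc (suc m)} _ g with argmin z<s (g ∘ suc)
... | i , min with g zero ≤? g (suc i)
...   | yes g₀≤ = zero  , λ { zero → ≤-refl ; (suc j) → ≤-trans g₀≤ (min j) }
...   | no  g₀≰ = suc i , λ { zero → <⇒≤ (≰⇒> g₀≰) ; (suc j) → min j }

argmax : ∀ {m} → 0 < m → (g : Vector ℕ m) → ∃ λ i → ∀ j → g j ≤ g i
argmax {suc zero}    _ g = zero , λ { zero → ≤-refl }
argmax {suc (suc m)} _ g with argmax z<s (g ∘ suc)
... | i , max with g (suc i) ≤? g zero
...   | yes ≤g₀ = zero  , λ { zero → ≤-refl ; (suc j) → ≤-trans (max j) ≤g₀ }
...   | no  ≰g₀ = suc i , λ { zero → <⇒≤ (≰⇒> ≰g₀) ; (suc j) → max j }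

∃-≤-mean : ∀ {m} → 0 < m → (g : Vector ℕ m) → ∃ λ i → g i * m ≤ sum g
∃-≤-mean {m} 0<m g with argmin 0<m g
... | i , min = i , subst (_≤ sum g) (trans (∑-const m (g i)) (*-comm m (g i))) (∑-mono-≤ min)

∃-≥-mean : ∀ {m} → 0 < m → (g : Vector ℕ m) → ∃ λ i → sum g ≤ g i * m
∃-≥-mean {m} 0<m g with argmax 0<m g
... | i , max = i , subst (sum g ≤_) (trans (∑-const m (g i)) (*-comm m (g i))) (∑-mono-≤ max)

x≤⌊a/d⌋⇔x*d≤a : ∀ {x a d} → 0 < d → x ≤ ⌊ a / d ⌋ ⇔ x * d ≤ a
x≤⌊a/d⌋⇔x*d≤a {x} {a} {d@(suc _)} _ = mk⇔
  (λ x≤a/d → ≤-trans (*-monoˡ-≤ d x≤a/d) (m/n*n≤m a d))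
  (λ x*d≤a → subst (_≤ a / d) (m*n/n≡m x d) (/-monoˡ-≤ d x*d≤a))

⌈a/d⌉≤x⇔a≤x*d : ∀ {x a d} → 0 < d → ⌈ a / d ⌉ ≤ x ⇔ a ≤ x * d
⌈a/d⌉≤x⇔a≤x*d {x} {a} {d@(suc d-1)} _ = mk⇔
  (λ ⌈a/d⌉≤x → +-cancelʳ-≤ d-1 a (x * d) (begin
    a + d-1                   ≡⟨ m≡m%n+[m/n]*n (a + d-1) d ⟩
    (a + d-1) % d + ⌈a/d⌉ * d ≤⟨ +-mono-≤ (s≤s⁻¹ (m%n<n (a + d-1) d)) (*-monoˡ-≤ d ⌈a/d⌉≤x) ⟩
    d-1 + x * d               ≡⟨ +-comm d-1 (x * d) ⟩
    x * d + d-1               ∎))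
  (λ a≤x*d → s≤s⁻¹ (m<n*o⇒m/o<n (begin-strict
    a + d-1     <⟨ +-monoʳ-< a (n<1+n d-1) ⟩
    a + d       ≤⟨ +-monoˡ-≤ d a≤x*d ⟩
    x * d + d   ≡⟨ +-comm (x * d) d ⟩
    suc x * d   ∎)))
  where
  open ≤-Reasoning
  ⌈a/d⌉ : ℕ
  ⌈a/d⌉ = (a + d-1) / d

x<⌈a/d⌉⇔x*d<a : ∀ {x a d} → 0 < d → x < ⌈ a / d ⌉ ⇔ x * d < a
x<⌈a/d⌉⇔x*d<a 0<d = mk⇔
  (λ x<⌈a/d⌉ → ≰⇒> (λ a≤x*d → <⇒≱ x<⌈a/d⌉ (from (⌈a/d⌉≤x⇔a≤x*d 0<d) a≤x*d)))
  (λ x*d<a → ≰⇒> (λ ⌈a/d⌉≤x → <⇒≱ x*d<a (to (⌈a/d⌉≤x⇔a≤x*d 0<d) ⌈a/d⌉≤x)))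

⌊/⌋-monoʳ-≤ : ∀ a {d e} → 0 < d → d ≤ e → ⌊ a / e ⌋ ≤ ⌊ a / d ⌋
⌊/⌋-monoʳ-≤ a {d} {e} 0<d d≤e = from (x≤⌊a/d⌋⇔x*d≤a 0<d)
  (≤-trans (*-monoʳ-≤ ⌊ a / e ⌋ d≤e) (to (x≤⌊a/d⌋⇔x*d≤a (<-≤-trans 0<d d≤e)) ≤-refl))

⌈/⌉-monoʳ-≤ : ∀ a {d e} → 0 < d → d ≤ e → ⌈ a / e ⌉ ≤ ⌈ a / d ⌉
⌈/⌉-monoʳ-≤ a {d} {e} 0<d d≤e = from (⌈a/d⌉≤x⇔a≤x*d (<-≤-trans 0<d d≤e))
  (≤-trans (to (⌈a/d⌉≤x⇔a≤x*d 0<d) ≤-refl) (*-monoʳ-≤ ⌈ a / d ⌉ d≤e))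

0<⌊k/t⌋ : ∀ {t k} → 0 < t → t ≤ k → 0 < ⌊ k / t ⌋
0<⌊k/t⌋ 0<t t≤k = from (x≤⌊a/d⌋⇔x*d≤a 0<t) (subst (_≤ _) (sym (*-identityˡ _)) t≤k)

0<⌈k/t⌉ : ∀ {t k} → 0 < t → t ≤ k → 0 < ⌈ k / t ⌉
0<⌈k/t⌉ 0<t t≤k = from (x<⌈a/d⌉⇔x*d<a 0<t) (<-≤-trans 0<t t≤k)

⌊a/d⌋≤⌈a/d⌉ : ∀ a d → ⌊ a / suc d ⌋ ≤ ⌈ a / suc d ⌉
⌊a/d⌋≤⌈a/d⌉ a d = /-monoˡ-≤ (suc d) (m≤m+n a d)

⌊a/d⌋<⌈a/d⌉ : ∀ a d → 0 < a % suc d → ⌊ a / suc d ⌋ < ⌈ a / suc d ⌉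
⌊a/d⌋<⌈a/d⌉ a d 0<a%d = from (x<⌈a/d⌉⇔x*d<a z<s) (begin-strict
  a / suc d * suc d              <⟨ m<n+m _ 0<a%d ⟩
  a % suc d + a / suc d * suc d  ≡⟨ m≡m%n+[m/n]*n a (suc d) ⟨
  a                              ∎)
  where open ≤-Reasoning

∑-+ : ∀ m n (h : ℕ → ℕ) → ∑[ j < m + n ] h (toℕ j) ≡ ∑[ j < m ] h (toℕ j) + ∑[ j < n ] h (m + toℕ j)
∑-+ zero    n h = refl
∑-+ (suc m) n h = trans (cong (h 0 +_) (∑-+ m n (h ∘ suc))) (sym (+-assoc (h 0) _ _))

∑-periodic : ∀ M q (h : ℕ → ℕ) → (∀ j → h (M + j) ≡ h j) →
             ∑[ j < q * M ] h (toℕ j) ≡ q * ∑[ j < M ] h (toℕ j)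
∑-periodic M zero    h periodic = refl
∑-periodic M (suc q) h periodic = begin
  ∑[ j < M + q * M ] h (toℕ j)                        ≡⟨ ∑-+ M (q * M) h ⟩
  period + ∑[ j < q * M ] h (M + toℕ j)               ≡⟨ cong (period +_) (sum-cong-≗ {q * M} (periodic ∘ toℕ)) ⟩
  period + ∑[ j < q * M ] h (toℕ j)                   ≡⟨ cong (period +_) (∑-periodic M q h periodic) ⟩
  period + q * period                                 ∎
  where
  open ≡-Reasoning
  period : ℕ
  period = ∑[ j < M ] h (toℕ j)

∑-𝟙-toℕ≡ : ∀ n l → ∑[ j < n ] 𝟙 (toℕ j ≟ℕ l) ≡ 𝟙 (l <? n)
∑-𝟙-toℕ≡ n l with l <? n
... | yes l<n = ∑-𝟙-one (λ j → toℕ j ≟ℕ l) (toℕ-fromℕ< l<n)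
                  (λ toℕj≡l → toℕ-injective (trans toℕj≡l (sym (toℕ-fromℕ< l<n))))
... | no  l≮n = ∑-𝟙-zero (λ j → toℕ j ≟ℕ l) (λ j toℕj≡l → l≮n (subst (_< n) toℕj≡l (toℕ<n j)))

residueCount : (M : ℕ) .{{_ : NonZero M}} → ℕ → ℕ → ℕ
residueCount M l n = ∑[ j < n ] 𝟙 (toℕ j % M ≟ℕ l)

residueCount≡ : ∀ M .{{_ : NonZero M}} {l} n → l < M → residueCount M l n ≡ n / M + 𝟙 (l <? n % M)
residueCount≡ M {l} n l<M = begin
  ∑[ j < n ] h (toℕ j)                                         ≡⟨ cong (λ m → ∑[ j < m ] h (toℕ j)) n≡ ⟩
  ∑[ j < n / M * M + n % M ] h (toℕ j)                         ≡⟨ ∑-+ (n / M * M) (n % M) h ⟩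
  ∑[ j < n / M * M ] h (toℕ j) + ∑[ j < n % M ] h (n / M * M + toℕ j)
    ≡⟨ cong₂ _+_ (∑-periodic M (n / M) h periodic) (sum-cong-≗ {n % M} (λ j → shift (toℕ j))) ⟩
  n / M * ∑[ j < M ] h (toℕ j) + ∑[ j < n % M ] h (toℕ j)
    ≡⟨ cong₂ _+_ (cong (n / M *_) (trans (initial M ≤-refl) (𝟙-yes (l <? M) l<M)))
                 (initial (n % M) (<⇒≤ (m%n<n n M))) ⟩
  n / M * 1 + 𝟙 (l <? n % M)                                   ≡⟨ cong (_+ 𝟙 (l <? n % M)) (*-identityʳ (n / M)) ⟩
  n / M + 𝟙 (l <? n % M)                                       ∎
  where
  open ≡-Reasoning
  h : ℕ → ℕ
  h j = 𝟙 (j % M ≟ℕ l)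
  n≡ : n ≡ n / M * M + n % M
  n≡ = trans (m≡m%n+[m/n]*n n M) (+-comm (n % M) _)
  periodic : ∀ j → h (M + j) ≡ h j
  periodic j = cong (λ x → 𝟙 (x ≟ℕ l)) (trans (cong (_% M) (+-comm M j)) ([m+n]%n≡m%n j M))
  shift : ∀ j → h (n / M * M + j) ≡ h j
  shift j = cong (λ x → 𝟙 (x ≟ℕ l)) (trans (cong (_% M) (+-comm (n / M * M) j)) ([m+kn]%n≡m%n j (n / M) M))
  initial : ∀ m → m ≤ M → ∑[ j < m ] h (toℕ j) ≡ 𝟙 (l <? m)
  initial m m≤M = trans (sum-cong-≗ {m} (λ j → cong (λ x → 𝟙 (x ≟ℕ l)) (j%M≡j j))) (∑-𝟙-toℕ≡ m l)
    where
    j%M≡j : ∀ (j : Fin m) → toℕ j % M ≡ toℕ j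
    j%M≡j j = m<n⇒m%n≡m (<-≤-trans (toℕ<n j) m≤M)

⌊n/M⌋≤residueCount : ∀ M {l} n → l < suc M → ⌊ n / suc M ⌋ ≤ residueCount (suc M) l n
⌊n/M⌋≤residueCount M n l<M rewrite residueCount≡ (suc M) n l<M = m≤m+n _ _

residueCount≤⌈n/M⌉ : ∀ M {l} n → l < suc M → residueCount (suc M) l n ≤ ⌈ n / suc M ⌉
residueCount≤⌈n/M⌉ M {l} n l<M rewrite residueCount≡ (suc M) n l<M with l <? n % suc M
... | yes l<n%M = subst (_≤ ⌈ n / suc M ⌉) (+-comm 1 (n / suc M)) (⌊a/d⌋<⌈a/d⌉ n M (≤-<-trans z≤n l<n%M))
... | no  _     = subst (_≤ ⌈ n / suc M ⌉) (sym (+-identityʳ (n / suc M))) (⌊a/d⌋≤⌈a/d⌉ n M)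

length-filter-tabulate : ∀ {m} {P : Pred A p} (P? : Decidable P) (g : Fin m → A) →
                         length (filter P? (tabulate g)) ≡ ∑[ i < m ] 𝟙 (P? (g i))
length-filter-tabulate {m = zero}  P? g = refl
length-filter-tabulate {m = suc m} P? g with P? (g zero)
... | yes _ = cong suc (length-filter-tabulate P? (g ∘ suc))
... | no  _ = length-filter-tabulate P? (g ∘ suc)

length-filter-cartesianProduct : ∀ {m n} {P : Pred (A × B) p} (P? : Decidable P) (g : Fin m → A) (h : Fin n → B) →
  length (filter P? (cartesianProduct (tabulate g) (tabulate h))) ≡ ∑[ i < m ] ∑[ j < n ] 𝟙 (P? (g i , h j))
length-filter-cartesianProduct {m = zero}  P? g h = refl
length-filter-cartesianProduct {A = A} {B = B} {m = suc m} {n} P? g h = begin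
  length (filter P? (row ++ rest))                 ≡⟨ cong length (filter-++ P? row rest) ⟩
  length (filter P? row ++ filter P? rest)         ≡⟨ length-++ (filter P? row) ⟩
  length (filter P? row) + length (filter P? rest)
    ≡⟨ cong (_+ length (filter P? rest)) (cong (length ∘ filter P?) (map-tabulate h (g zero ,_))) ⟩
  length (filter P? (tabulate (λ j → g zero , h j))) + length (filter P? rest)
    ≡⟨ cong₂ _+_ (length-filter-tabulate P? (λ j → g zero , h j))
                 (length-filter-cartesianProduct P? (g ∘ suc) h) ⟩
  ∑[ i < suc m ] ∑[ j < n ] 𝟙 (P? (g i , h j))     ∎
  where
  open ≡-Reasoning
  row : List (A × B)
  row  = map (g zero ,_) (tabulate h)
  rest : List (A × B)
  rest = cartesianProduct (tabulate (g ∘ suc)) (tabulate h)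

classSize≡∑∑ : ∀ {t n k} (f : Fin t × Fin n → Fin k) c →
               classSize t n k f c ≡ ∑[ i < t ] ∑[ j < n ] 𝟙 (f (i , j) ≟ c)
classSize≡∑∑ f c = length-filter-cartesianProduct (λ v → f v ≟ c) (λ i → i) (λ j → j)

module ColourCounting {t n k} (f : Fin t × Fin n → Fin k) (proper : IsProperColoring t n k f) where

  size : Fin k → ℕ
  size = classSize t n k f

  Uses : Fin t → Fin k → Set
  Uses i c = ∃ λ j → f (i , j) ≡ c

  uses? : ∀ i c → Dec (Uses i c)
  uses? i c = any? (λ j → f (i , j) ≟ c)

  partCount : Fin t → Fin k → ℕ
  partCount i c = ∑[ j < n ] 𝟙 (f (i , j) ≟ c)

  coloursOn : Fin t → ℕ
  coloursOn i = ∑[ c < k ] 𝟙 (uses? i c)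

  Uses-unique : ∀ {i i' c} → Uses i c → Uses i' c → i ≡ i'
  Uses-unique {i} {i'} (j , fij≡c) (j' , fi'j'≡c) with i ≟ i'
  ... | yes i≡i' = i≡i'
  ... | no  i≢i' = contradiction (trans fij≡c (sym fi'j'≡c)) (proper (i , j) (i' , j') i≢i')

  partCount-unused : ∀ {i c} → ¬ Uses i c → partCount i c ≡ 0
  partCount-unused {i} {c} ¬uses = ∑-𝟙-zero (λ j → f (i , j) ≟ c) (λ j fij≡c → ¬uses (j , fij≡c))

  partCount≡ : ∀ i c → partCount i c ≡ 𝟙 (uses? i c) * size c
  partCount≡ i c with uses? i c
  ... | no  ¬uses = partCount-unused ¬uses
  ... | yes uses  = sym (begin
    size c + 0                 ≡⟨ +-identityʳ (size c) ⟩
    size c                     ≡⟨ classSize≡∑∑ f c ⟩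
    ∑[ i' < t ] partCount i' c ≡⟨ ∑-single (λ i' → partCount i' c) i others-unused ⟩
    partCount i c              ∎)
    where
    open ≡-Reasoning
    others-unused : ∀ i' → i' ≢ i → partCount i' c ≡ 0
    others-unused i' i'≢i = partCount-unused (λ uses' → i'≢i (Uses-unique uses' uses))

  ∑-partCount : ∀ i → ∑[ c < k ] partCount i c ≡ n
  ∑-partCount i = begin
    ∑[ c < k ] ∑[ j < n ] 𝟙 (f (i , j) ≟ c) ≡⟨ ∑-comm (λ c j → 𝟙 (f (i , j) ≟ c)) ⟩
    ∑[ j < n ] ∑[ c < k ] 𝟙 (f (i , j) ≟ c) ≡⟨ sum-cong-≗ {n} (λ j → ∑-𝟙-one (f (i , j) ≟_) refl sym) ⟩
    ∑[ j < n ] 1                            ≡⟨ ∑-const n 1 ⟩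
    n * 1                                   ≡⟨ *-identityʳ n ⟩
    n                                       ∎
    where open ≡-Reasoning

  size≡∑uses*size : ∀ c → size c ≡ (∑[ i < t ] 𝟙 (uses? i c)) * size c
  size≡∑uses*size c = begin
    size c                              ≡⟨ classSize≡∑∑ f c ⟩
    ∑[ i < t ] partCount i c            ≡⟨ sum-cong-≗ {t} (λ i → partCount≡ i c) ⟩
    ∑[ i < t ] (𝟙 (uses? i c) * size c)   ≡⟨ *-distribʳ-sum (size c) (λ i → 𝟙 (uses? i c)) ⟨
    (∑[ i < t ] 𝟙 (uses? i c)) * size c ∎
    where open ≡-Reasoning

  ∑-uses≤1 : ∀ c → ∑[ i < t ] 𝟙 (uses? i c) ≤ 1
  ∑-uses≤1 c = ∑-𝟙-≤1 (λ i → uses? i c) Uses-unique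

  ∑-uses≡1 : ∀ c → 0 < size c → ∑[ i < t ] 𝟙 (uses? i c) ≡ 1
  ∑-uses≡1 c 0<size = *-cancelʳ-≡ _ 1 (size c) {{>-nonZero 0<size}}
    (sym (trans (*-identityˡ (size c)) (size≡∑uses*size c)))

  ∑-coloursOn≤k : ∑[ i < t ] coloursOn i ≤ k
  ∑-coloursOn≤k = begin
    ∑[ i < t ] coloursOn i               ≡⟨ ∑-comm (λ i c → 𝟙 (uses? i c)) ⟩
    ∑[ c < k ] ∑[ i < t ] 𝟙 (uses? i c) ≤⟨ ∑-mono-≤ ∑-uses≤1 ⟩
    ∑[ c < k ] 1                         ≡⟨ trans (∑-const k 1) (*-identityʳ k) ⟩
    k                                    ∎
    where open ≤-Reasoning

  k≤∑-coloursOn : (∀ c → 0 < size c) → k ≤ ∑[ i < t ] coloursOn i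
  k≤∑-coloursOn 0<size = begin
    k                                    ≡⟨ trans (∑-const k 1) (*-identityʳ k) ⟨
    ∑[ c < k ] 1                         ≡⟨ sum-cong-≗ {k} (λ c → ∑-uses≡1 c (0<size c)) ⟨
    ∑[ c < k ] ∑[ i < t ] 𝟙 (uses? i c) ≡⟨ ∑-comm (λ i c → 𝟙 (uses? i c)) ⟨
    ∑[ i < t ] coloursOn i               ∎
    where open ≤-Reasoning

  n≡∑uses*size : ∀ i → n ≡ ∑[ c < k ] (𝟙 (uses? i c) * size c)
  n≡∑uses*size i = trans (sym (∑-partCount i)) (sum-cong-≗ {k} (partCount≡ i))

  n≤coloursOn*max : ∀ {M} i → (∀ c → size c ≤ M) → n ≤ coloursOn i * M
  n≤coloursOn*max {M} i size≤M = begin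
    n                                 ≡⟨ n≡∑uses*size i ⟩
    ∑[ c < k ] (𝟙 (uses? i c) * size c) ≤⟨ ∑-mono-≤ (λ c → *-monoʳ-≤ (𝟙 (uses? i c)) (size≤M c)) ⟩
    ∑[ c < k ] (𝟙 (uses? i c) * M)      ≡⟨ *-distribʳ-sum M (λ c → 𝟙 (uses? i c)) ⟨
    coloursOn i * M                   ∎
    where open ≤-Reasoning

  coloursOn*min≤n : ∀ {m} i → (∀ c → m ≤ size c) → coloursOn i * m ≤ n
  coloursOn*min≤n {m} i m≤size = begin
    coloursOn i * m                   ≡⟨ *-distribʳ-sum m (λ c → 𝟙 (uses? i c)) ⟩
    ∑[ c < k ] (𝟙 (uses? i c) * m)      ≤⟨ ∑-mono-≤ (λ c → *-monoʳ-≤ (𝟙 (uses? i c)) (m≤size c)) ⟩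
    ∑[ c < k ] (𝟙 (uses? i c) * size c) ≡⟨ n≡∑uses*size i ⟨
    n                                 ∎
    where open ≤-Reasoning

  ⌈n/⌊k/t⌋⌉≤max : ∀ {M} → 0 < t → t ≤ k → (∀ c → size c ≤ M) → ⌈ n / ⌊ k / t ⌋ ⌉ ≤ M
  ⌈n/⌊k/t⌋⌉≤max {M} 0<t t≤k size≤M with ∃-≤-mean 0<t coloursOn
  ... | i , coloursOn*t≤∑ = from (⌈a/d⌉≤x⇔a≤x*d (0<⌊k/t⌋ 0<t t≤k)) (begin
    n               ≤⟨ n≤coloursOn*max i size≤M ⟩
    coloursOn i * M ≤⟨ *-monoˡ-≤ M coloursOn≤⌊k/t⌋ ⟩
    ⌊ k / t ⌋ * M   ≡⟨ *-comm ⌊ k / t ⌋ M ⟩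
    M * ⌊ k / t ⌋   ∎)
    where
    open ≤-Reasoning
    coloursOn≤⌊k/t⌋ : coloursOn i ≤ ⌊ k / t ⌋
    coloursOn≤⌊k/t⌋ = from (x≤⌊a/d⌋⇔x*d≤a 0<t) (≤-trans coloursOn*t≤∑ ∑-coloursOn≤k)

  min≤⌊n/⌈k/t⌉⌋ : ∀ m → 0 < t → t ≤ k → (∀ c → m ≤ size c) → m ≤ ⌊ n / ⌈ k / t ⌉ ⌋
  min≤⌊n/⌈k/t⌉⌋ zero        _   _   _      = z≤n
  min≤⌊n/⌈k/t⌉⌋ m@(suc _) 0<t t≤k m≤size with ∃-≥-mean 0<t coloursOn
  ... | i , ∑≤coloursOn*t = from (x≤⌊a/d⌋⇔x*d≤a (0<⌈k/t⌉ 0<t t≤k)) (begin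
    m * ⌈ k / t ⌉   ≤⟨ *-monoʳ-≤ m ⌈k/t⌉≤coloursOn ⟩
    m * coloursOn i ≡⟨ *-comm m (coloursOn i) ⟩
    coloursOn i * m ≤⟨ coloursOn*min≤n i m≤size ⟩
    n               ∎)
    where
    open ≤-Reasoning
    ⌈k/t⌉≤coloursOn : ⌈ k / t ⌉ ≤ coloursOn i
    ⌈k/t⌉≤coloursOn = from (⌈a/d⌉≤x⇔a≤x*d 0<t)
      (≤-trans (k≤∑-coloursOn (λ c → <-≤-trans z<s (m≤size c))) ∑≤coloursOn*t)

necessity : ∀ {r t n k} → 0 < t → t ≤ k → HasREquitableColoring r t n k →
            ⌈ n / ⌊ k / t ⌋ ⌉ ∸ ⌊ n / ⌈ k / t ⌉ ⌋ ≤ r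
necessity {r} {t} {n} {k} 0<t t≤k (f , proper , equitable) =
  subst (_ ≤_) (m+n∸m≡n (size smallest) r)
    (∸-mono (⌈n/⌊k/t⌋⌉≤max 0<t t≤k (λ c → equitable c smallest))
            (min≤⌊n/⌈k/t⌉⌋ (size smallest) 0<t t≤k (proj₂ (argmin 0<k size))))
  where
  open ColourCounting f proper
  0<k : 0 < k
  0<k = <-≤-trans 0<t t≤k
  smallest : Fin k
  smallest = proj₁ (argmin 0<k size)

base-injective : ∀ {d} .{{_ : NonZero d}} {i i' l l'} → i < d → i' < d →
                 i + l * d ≡ i' + l' * d → i ≡ i' × l ≡ l'
base-injective {d} {i} {i'} {l} {l'} i<d i'<d eq = i≡i' , *-cancelʳ-≡ l l' d (+-cancelˡ-≡ i _ _ eq')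
  where
  open ≡-Reasoning
  i≡i' : i ≡ i'
  i≡i' = begin
    i                 ≡⟨ m<n⇒m%n≡m i<d ⟨
    i % d             ≡⟨ [m+kn]%n≡m%n i l d ⟨
    (i + l * d) % d   ≡⟨ cong (_% d) eq ⟩
    (i' + l' * d) % d ≡⟨ [m+kn]%n≡m%n i' l' d ⟩
    i' % d            ≡⟨ m<n⇒m%n≡m i'<d ⟩
    i'                ∎
  eq' : i + l * d ≡ i + l' * d
  eq' = trans eq (cong (_+ l' * d) (sym i≡i'))

module ResidueColouring {t k} (0<t : 0 < t) (t≤k : t ≤ k) (n : ℕ) where

  -- The number of colours c < k with c ≡ i (mod t), in a form that is visibly nonzero.
  width : Fin t → ℕ
  width i = suc (⌊ (k ∸ suc (toℕ i)) / t ⌋)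

  <width⇔ : ∀ i l → l < width i ⇔ toℕ i + l * t < k
  <width⇔ i l = mk⇔
    (λ l<w → subst (_≤ k) reorder (m≤o∸n⇒m+n≤o (l * t) i<k (to (x≤⌊a/d⌋⇔x*d≤a 0<t) (s≤s⁻¹ l<w))))
    (λ i+lt<k → s≤s (from (x≤⌊a/d⌋⇔x*d≤a 0<t)
                            (m+n≤o⇒m≤o∸n (l * t) (subst (_≤ k) (sym reorder) i+lt<k))))
    where
    i<k : toℕ i < k
    i<k = <-≤-trans (toℕ<n i) t≤k
    reorder : l * t + suc (toℕ i) ≡ suc (toℕ i + l * t)
    reorder = trans (+-suc (l * t) (toℕ i)) (cong suc (+-comm (l * t) (toℕ i)))

  ⌊k/t⌋≤width : ∀ i → ⌊ k / t ⌋ ≤ width i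
  ⌊k/t⌋≤width i = x*t≤k⇒x≤width ⌊ k / t ⌋ (to (x≤⌊a/d⌋⇔x*d≤a 0<t) ≤-refl)
    where
    x*t≤k⇒x≤width : ∀ x → x * t ≤ k → x ≤ width i
    x*t≤k⇒x≤width zero    _       = z≤n
    x*t≤k⇒x≤width (suc x) sx*t≤k =
      from (<width⇔ i x) (<-≤-trans (+-monoˡ-< (x * t) (toℕ<n i)) sx*t≤k)

  width≤⌈k/t⌉ : ∀ i → width i ≤ ⌈ k / t ⌉
  width≤⌈k/t⌉ i = from (x<⌈a/d⌉⇔x*d<a 0<t)
    (≤-<-trans (m≤n+m (w-1 * t) (toℕ i)) (to (<width⇔ i w-1) (n<1+n w-1)))
    where
    w-1 : ℕ
    w-1 = ⌊ (k ∸ suc (toℕ i)) / t ⌋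

  colour : Fin t × Fin n → Fin k
  colour (i , j) = fromℕ< (to (<width⇔ i (toℕ j % width i)) (m%n<n (toℕ j) (width i)))

  toℕ-colour : ∀ i j → toℕ (colour (i , j)) ≡ toℕ i + (toℕ j % width i) * t
  toℕ-colour i j = toℕ-fromℕ< _

  module _ (c : Fin k) where
    instance
      t≢0 : NonZero t
      t≢0 = >-nonZero 0<t

    part : Fin t
    part = fromℕ< (m%n<n (toℕ c) t)

    level : ℕ
    level = toℕ c / t

    toℕ-c : toℕ c ≡ toℕ part + level * t
    toℕ-c = trans (m≡m%n+[m/n]*n (toℕ c) t) (cong (_+ level * t) (sym (toℕ-fromℕ< _)))

    level<width : level < width part
    level<width = from (<width⇔ part level) (subst (_< k) toℕ-c (toℕ<n c))

    colour≡c⇔ : ∀ i j → colour (i , j) ≡ c ⇔ (i ≡ part × toℕ j % width i ≡ level)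
    colour≡c⇔ i j = mk⇔
      (λ colour≡c → decode (base-injective (toℕ<n i) (toℕ<n part)
                      (trans (sym (toℕ-colour i j)) (trans (cong toℕ colour≡c) toℕ-c))))
      (λ { (refl , j%w≡level) → toℕ-injective
             (trans (toℕ-colour part j) (trans (cong (λ x → toℕ part + x * t) j%w≡level) (sym toℕ-c))) })
      where
      decode : toℕ i ≡ toℕ part × toℕ j % width i ≡ level → i ≡ part × toℕ j % width i ≡ level
      decode (toℕi≡ , j%w≡level) = toℕ-injective toℕi≡ , j%w≡level

    classSize-colour : classSize t n k colour c ≡ residueCount (width part) level n
    classSize-colour = begin
      classSize t n k colour c                      ≡⟨ classSize≡∑∑ colour c ⟩
      ∑[ i < t ] ∑[ j < n ] 𝟙 (colour (i , j) ≟ c) ≡⟨ ∑-single _ part other-parts ⟩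
      ∑[ j < n ] 𝟙 (colour (part , j) ≟ c)         ≡⟨ sum-cong-≗ {n} (λ j → 𝟙-cong _ _ (in-part j)) ⟩
      residueCount (width part) level n             ∎
      where
      open ≡-Reasoning
      other-parts : ∀ i → i ≢ part → ∑[ j < n ] 𝟙 (colour (i , j) ≟ c) ≡ 0
      other-parts i i≢part =
        ∑-𝟙-zero (λ j → colour (i , j) ≟ c) (λ j → i≢part ∘ proj₁ ∘ to (colour≡c⇔ i j))
      in-part : ∀ j → colour (part , j) ≡ c ⇔ toℕ j % width part ≡ level
      in-part j = mk⇔ (proj₂ ∘ to (colour≡c⇔ part j))
                      (λ j%w≡level → from (colour≡c⇔ part j) (refl , j%w≡level))

  colour-proper : IsProperColoring t n k colour
  colour-proper (i , j) (i' , j') i≢i' same = i≢i' (trans (proj₁ (to (colour≡c⇔ c i j) same))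
                                                       (sym (proj₁ (to (colour≡c⇔ c i' j') refl))))
    where
    c : Fin k
    c = colour (i' , j')

  classSize-colour≤⌈n/⌊k/t⌋⌉ : ∀ c → classSize t n k colour c ≤ ⌈ n / ⌊ k / t ⌋ ⌉
  classSize-colour≤⌈n/⌊k/t⌋⌉ c = begin
    classSize t n k colour c                  ≡⟨ classSize-colour c ⟩
    residueCount (width (part c)) (level c) n ≤⟨ residueCount≤⌈n/M⌉ _ n (level<width c) ⟩
    ⌈ n / width (part c) ⌉                    ≤⟨ ⌈/⌉-monoʳ-≤ n (0<⌊k/t⌋ 0<t t≤k) (⌊k/t⌋≤width (part c)) ⟩
    ⌈ n / ⌊ k / t ⌋ ⌉                         ∎
    where open ≤-Reasoning

  ⌊n/⌈k/t⌉⌋≤classSize-colour : ∀ c → ⌊ n / ⌈ k / t ⌉ ⌋ ≤ classSize t n k colour c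
  ⌊n/⌈k/t⌉⌋≤classSize-colour c = begin
    ⌊ n / ⌈ k / t ⌉ ⌋                         ≤⟨ ⌊/⌋-monoʳ-≤ n z<s (width≤⌈k/t⌉ (part c)) ⟩
    ⌊ n / width (part c) ⌋                    ≤⟨ ⌊n/M⌋≤residueCount _ n (level<width c) ⟩
    residueCount (width (part c)) (level c) n ≡⟨ classSize-colour c ⟨
    classSize t n k colour c                  ∎
    where open ≤-Reasoning

  colour-equitable : ∀ {r} → ⌈ n / ⌊ k / t ⌋ ⌉ ∸ ⌊ n / ⌈ k / t ⌉ ⌋ ≤ r →
                     IsREquitable r t n k colour
  colour-equitable {r} gap≤r c c' = begin
    classSize t n k colour c      ≤⟨ classSize-colour≤⌈n/⌊k/t⌋⌉ c ⟩
    upper                         ≤⟨ m≤n+m∸n upper lower ⟩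
    lower + (upper ∸ lower)       ≤⟨ +-mono-≤ (⌊n/⌈k/t⌉⌋≤classSize-colour c') gap≤r ⟩
    classSize t n k colour c' + r ∎
    where
    open ≤-Reasoning
    upper lower : ℕ
    upper = ⌈ n / ⌊ k / t ⌋ ⌉
    lower = ⌊ n / ⌈ k / t ⌉ ⌋

sufficiency : ∀ {r t n k} → 0 < t → t ≤ k → ⌈ n / ⌊ k / t ⌋ ⌉ ∸ ⌊ n / ⌈ k / t ⌉ ⌋ ≤ r →
              HasREquitableColoring r t n k
sufficiency {n = n} 0<t t≤k gap≤r = colour , colour-proper , colour-equitable gap≤r
  where open ResidueColouring 0<t t≤k n

corollary13 : (r t n k : ℕ) → 2 ≤ t → 1 ≤ n → t ≤ k →
    HasREquitableColoring r t n k ⇔ (⌈ n / ⌊ k / t ⌋ ⌉ ∸ ⌊ n / ⌈ k / t ⌉ ⌋ ≤ r)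
corollary13 r t n k 2≤t _ t≤k = mk⇔ (necessity 0<t t≤k) (sufficiency 0<t t≤k)
  where
  0<t : 0 < t
  0<t = <-≤-trans z<s 2≤t
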